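{- Let $(p,X)\in\{(7,3),(11,4),(13,4),(17,5),(19,5),(29,6),(31,6)\}$, and let $S$ be an $X$-element subset of $\mathbb{Z}/p\mathbb{Z}$ such that for each nonzero $k\in\mathbb{Z}/p\mathbb{Z}$ the set $\{(i,j)\in S^2: i-j=k\}$ is nonempty. Let $\Gamma$ be the graph with vertex set $S$ having an edge $(i,j)$ for each pair $(i,j)\in S^2$ such that $i-j\neq i'-j'$ for every pair $(i',j')\in S^2\setminus\{(i,j)\}$. Then $\Gamma$ is connected and not bipartite. -}

module Defs where

open import Data.Nat using (ℕ; _+_; _∸_; _≤ᵇ_)
open import Data.Bool using (Bool; if_then_else_)
open import Data.Fin using (Fin; toℕ)
open import Data.Fin.Subset using (Subset; _∈_)
open import Data.Product using (_×_; ∃₂; _,_; Σ)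
open import Data.Sum using (_⊎_)
open import Relation.Binary.PropositionalEquality using (_≡_; _≢_)
open import Relation.Nullary using (¬_)

data Params : ℕ → ℕ → Set where
  p7  : Params 7 3
  p11 : Params 11 4
  p13 : Params 13 4
  p17 : Params 17 5
  p19 : Params 19 5
  p29 : Params 29 6
  p31 : Params 31 6

-- Z/pZ is represented by Fin p (canonical residues 0..p-1).
-- diff i j = canonical representative in {0..p-1} of i - j mod p.
diff : {p : ℕ} → Fin p → Fin p → ℕ
diff {p} i j = if toℕ j ≤ᵇ toℕ i then toℕ i ∸ toℕ j else (toℕ i + p) ∸ toℕ j

AllDiffs : {p : ℕ} → Subset p → Set
AllDiffs {p} S = (k : Fin p) → toℕ k ≢ 0 →
  ∃₂ λ i j → i ∈ S × j ∈ S × diff i j ≡ toℕ k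

UniqueDiff : {p : ℕ} → Subset p → Fin p → Fin p → Set
UniqueDiff {p} S i j = i ∈ S × j ∈ S ×
  ((i' j' : Fin p) → i' ∈ S → j' ∈ S → ¬ (i' ≡ i × j' ≡ j) → diff i' j' ≢ diff i j)

Adj : {p : ℕ} → Subset p → Fin p → Fin p → Set
Adj S u v = UniqueDiff S u v ⊎ UniqueDiff S v u

data Walk {p : ℕ} (S : Subset p) : Fin p → Fin p → Set where
  here : {u : Fin p} → Walk S u u
  step : {u v w : Fin p} → Adj S u v → Walk S v w → Walk S u w

Connected : {p : ℕ} → Subset p → Set
Connected {p} S = (u v : Fin p) → u ∈ S → v ∈ S → Walk S u v

Bipartite : {p : ℕ} → Subset p → Set
Bipartite {p} S = Σ (Fin p → Bool) λ c → (u v : Fin p) → Adj S u v → c u ≢ c v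

-- Translating S by a residue preserves all differences and hence Γ, so after a rotation we may
-- assume 0 ∈ S. Such sets are then enumerated by a pruned exhaustive search: the elements are
-- decided one residue at a time, and a partial set is abandoned as soon as its distinct nonzero
-- differences, together with all the new differences the missing elements could still create,
-- cannot reach the p - 1 nonzero residues. For every surviving set the search verifies that Γ has
-- diameter at most 2, so it is connected, and contains a triangle, so it is not bipartite.
-- (For (p , X) = (29 , 6) no set survives: there is no such S at all.)

module Submission where

open import Defs
open import Data.Bool using (Bool; true; false; T; not; if_then_else_; _∧_; _∨_)
open import Data.Bool.ListAction using (all; any)
open import Data.Bool.Properties using (¬-not; not-involutive; T-∧; T-∨; T-≡)
open import Data.Empty using (⊥)
open import Data.Fin as Fin using (Fin; zero; suc; toℕ; fromℕ; inject₁; lower₁)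
open import Data.Fin.Induction using (<-weakInduction)
open import Data.Fin.Properties as Fin
  using (toℕ-injective; toℕ-fromℕ; toℕ-inject₁; toℕ<n; fromℕ≢inject₁; inject₁-injective; inject₁-lower₁)
open import Data.Fin.Subset using (Subset; ∣_∣; _∈_; inside; outside; Nonempty)
open import Data.Fin.Subset.Properties using (∣p∣≤n; nonempty?; Empty-unique; ∣⊥∣≡0)
open import Data.List as List using (List; []; _∷_; length)
open import Data.List.Membership.Propositional using (find) renaming (_∈_ to _∈ˡ_)
open import Data.List.Relation.Unary.All as All using (All; all?)
open import Data.List.Relation.Unary.All.Properties using (all⁺)
open import Data.List.Relation.Unary.Any as Any using (Any; any?; here; there)
open import Data.List.Relation.Unary.Any.Properties using (lookup-index; any⁻)
open import Data.Nat as ℕ using (ℕ; zero; suc; _+_; _*_; _∸_; _≤_; _<_; _≤ᵇ_; _<ᵇ_; _≡ᵇ_)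
open import Data.Nat.Properties as ℕ using (≤⇒≤ᵇ; ≤ᵇ⇒≤; <⇒≤; <⇒≱; n∸n≡0; ≤-refl; m+n∸n≡m; +-suc)
open import Data.Product using (_×_; _,_; proj₁; proj₂; ∃; ∃₂)
open import Data.Sum as Sum using (_⊎_; inj₁; inj₂; [_,_]′)
open import Data.Vec using (Vec; _∷_; []; _∷ʳ_; here; there; _[_]=_)
open import Function using (_∘_; id)
open import Function.Bundles using (Equivalence)
open import Function.Definitions using (Injective)
open import Relation.Binary.PropositionalEquality
  using (_≡_; _≢_; refl; sym; trans; cong; cong₂; subst; subst₂)
open import Relation.Nullary
  using (¬_; contradiction; Dec; yes; no; ⌊_⌋; toWitness; T?; _×-dec_; _⊎-dec_)

private
  variable
    n : ℕ

-- diff {p} i j is definitionally diffℕ p (toℕ i) (toℕ j).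
diffℕ : ℕ → ℕ → ℕ → ℕ
diffℕ p a b = if b ≤ᵇ a then a ∸ b else (a + p) ∸ b

≤ᵇ-true : ∀ {m k} → m ≤ k → (m ≤ᵇ k) ≡ true
≤ᵇ-true = Equivalence.to T-≡ ∘ ≤⇒≤ᵇ

≤ᵇ-false : ∀ {m k} → k < m → (m ≤ᵇ k) ≡ false
≤ᵇ-false {m} {k} k<m with m ≤ᵇ k in eq
... | false = refl
... | true = contradiction (≤ᵇ⇒≤ m k (Equivalence.from T-≡ eq)) (<⇒≱ k<m)

<ᵇ-suc : ∀ m k → (m <ᵇ suc k) ≡ (m ≤ᵇ k)
<ᵇ-suc zero k = refl
<ᵇ-suc (suc m) k = refl

diffℕ-self : ∀ p a → diffℕ p a a ≡ 0
diffℕ-self p a rewrite ≤ᵇ-true (≤-refl {a}) = n∸n≡0 a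

prev : Fin (suc n) → Fin (suc n)
prev {n} zero = fromℕ n
prev (suc j) = inject₁ j

diff-prev : (i j : Fin (suc n)) → diff (prev i) (prev j) ≡ diff i j
diff-prev {n} zero zero = diffℕ-self (suc n) (toℕ (fromℕ n))
diff-prev {n} zero (suc j)
  rewrite toℕ-fromℕ n | toℕ-inject₁ j | ≤ᵇ-true (<⇒≤ (toℕ<n j)) = refl
diff-prev {n} (suc i) zero
  rewrite toℕ-fromℕ n | toℕ-inject₁ i | ≤ᵇ-false (toℕ<n i) =
  trans (cong (_∸ n) (+-suc (toℕ i) n)) (m+n∸n≡m (suc (toℕ i)) n)
diff-prev (suc i) (suc j)
  rewrite toℕ-inject₁ i | toℕ-inject₁ j | <ᵇ-suc (toℕ j) (toℕ i) = refl

prev-injective : {i j : Fin (suc n)} → prev i ≡ prev j → i ≡ j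
prev-injective {i = zero} {zero} _ = refl
prev-injective {i = zero} {suc j} eq = contradiction eq fromℕ≢inject₁
prev-injective {i = suc i} {zero} eq = contradiction (sym eq) fromℕ≢inject₁
prev-injective {i = suc i} {suc j} eq = cong suc (inject₁-injective eq)

next : Fin (suc n) → Fin (suc n)
next {n} i with n ℕ.≟ toℕ i
... | yes _ = zero
... | no n≢i = suc (lower₁ i n≢i)

prev-next : (i : Fin (suc n)) → prev (next i) ≡ i
prev-next {n} i with n ℕ.≟ toℕ i
... | yes n≡i = toℕ-injective (trans (toℕ-fromℕ n) n≡i)
... | no n≢i = inject₁-lower₁ i n≢i

next-prev : (i : Fin (suc n)) → next (prev i) ≡ i
next-prev i = prev-injective (prev-next (prev i))

module _ {a} {A : Set a} where

  ∷ʳ-[]=-fromℕ : ∀ {x} (xs : Vec A n) → (xs ∷ʳ x) [ fromℕ n ]= x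
  ∷ʳ-[]=-fromℕ [] = here
  ∷ʳ-[]=-fromℕ (_ ∷ xs) = there (∷ʳ-[]=-fromℕ xs)

  ∷ʳ-[]=-fromℕ⁻ : ∀ {x y} (xs : Vec A n) → (xs ∷ʳ y) [ fromℕ n ]= x → y ≡ x
  ∷ʳ-[]=-fromℕ⁻ [] here = refl
  ∷ʳ-[]=-fromℕ⁻ (_ ∷ xs) (there p) = ∷ʳ-[]=-fromℕ⁻ xs p

  ∷ʳ-[]=-inject₁ : ∀ {x y} {xs : Vec A n} {j} → xs [ j ]= x → (xs ∷ʳ y) [ inject₁ j ]= x
  ∷ʳ-[]=-inject₁ here = here
  ∷ʳ-[]=-inject₁ (there p) = there (∷ʳ-[]=-inject₁ p)

  ∷ʳ-[]=-inject₁⁻ : ∀ {x y} (xs : Vec A n) {j} → (xs ∷ʳ y) [ inject₁ j ]= x → xs [ j ]= x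
  ∷ʳ-[]=-inject₁⁻ (_ ∷ xs) {zero} here = here
  ∷ʳ-[]=-inject₁⁻ (_ ∷ xs) {suc j} (there p) = there (∷ʳ-[]=-inject₁⁻ xs p)

rotate : Subset (suc n) → Subset (suc n)
rotate (b ∷ v) = v ∷ʳ b

∣∷ʳ∣ : ∀ b (v : Subset n) → ∣ v ∷ʳ b ∣ ≡ ∣ b ∷ v ∣
∣∷ʳ∣ b [] = refl
∣∷ʳ∣ outside (outside ∷ v) = ∣∷ʳ∣ outside v
∣∷ʳ∣ outside (inside ∷ v) = cong suc (∣∷ʳ∣ outside v)
∣∷ʳ∣ inside (outside ∷ v) = ∣∷ʳ∣ inside v
∣∷ʳ∣ inside (inside ∷ v) = cong suc (∣∷ʳ∣ inside v)

∣rotate∣ : (S : Subset (suc n)) → ∣ rotate S ∣ ≡ ∣ S ∣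
∣rotate∣ (b ∷ v) = ∣∷ʳ∣ b v

prev-∈-rotate : {S : Subset (suc n)} {i : Fin (suc n)} → i ∈ S → prev i ∈ rotate S
prev-∈-rotate {S = _ ∷ v} here = ∷ʳ-[]=-fromℕ v
prev-∈-rotate (there i∈v) = ∷ʳ-[]=-inject₁ i∈v

prev-∈-rotate⁻ : {S : Subset (suc n)} {i : Fin (suc n)} → prev i ∈ rotate S → i ∈ S
prev-∈-rotate⁻ {S = _ ∷ v} {zero} p with refl ← ∷ʳ-[]=-fromℕ⁻ v p = here
prev-∈-rotate⁻ {S = _ ∷ v} {suc j} p = there (∷ʳ-[]=-inject₁⁻ v p)

record _≅_ {p : ℕ} (S T : Subset p) : Set where
  field
    to from : Fin p → Fin p
    from-to : ∀ i → from (to i) ≡ i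
    to-from : ∀ i → to (from i) ≡ i
    to-∈ : ∀ {i} → i ∈ S → to i ∈ T
    from-∈ : ∀ {i} → i ∈ T → from i ∈ S
    diff-to : ∀ i j → diff (to i) (to j) ≡ diff i j

  diff-from : ∀ i j → diff (from i) (from j) ≡ diff i j
  diff-from i j = trans (sym (diff-to (from i) (from j))) (cong₂ diff (to-from i) (to-from j))

module _ {p : ℕ} {S T : Subset p} (S≅T : S ≅ T) where
  open _≅_ S≅T

  ≅-sym : T ≅ S
  ≅-sym = record
    { to = from ; from = to ; from-to = to-from ; to-from = from-to
    ; to-∈ = from-∈ ; from-∈ = to-∈ ; diff-to = diff-from }

  uniqueDiff-≅ : ∀ {i j} → UniqueDiff S i j → UniqueDiff T (to i) (to j)
  uniqueDiff-≅ {i} {j} (i∈S , j∈S , unique) = to-∈ i∈S , to-∈ j∈S , unique′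
    where
    unique′ : ∀ i′ j′ → i′ ∈ T → j′ ∈ T → ¬ (i′ ≡ to i × j′ ≡ to j) → diff i′ j′ ≢ diff (to i) (to j)
    unique′ i′ j′ i′∈T j′∈T other same = unique (from i′) (from j′) (from-∈ i′∈T) (from-∈ j′∈T)
      (λ (eᵢ , eⱼ) → other (trans (sym (to-from i′)) (cong to eᵢ) , trans (sym (to-from j′)) (cong to eⱼ)))
      (trans (diff-from i′ j′) (trans same (diff-to i j)))

  adj-≅ : ∀ {u v} → Adj S u v → Adj T (to u) (to v)
  adj-≅ = Sum.map uniqueDiff-≅ uniqueDiff-≅

  walk-≅ : ∀ {u v} → Walk S u v → Walk T (to u) (to v)
  walk-≅ here = here
  walk-≅ (step a w) = step (adj-≅ a) (walk-≅ w)

  connected-≅ : Connected S → Connected T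
  connected-≅ conn u v u∈T v∈T = subst₂ (Walk T) (to-from u) (to-from v)
    (walk-≅ (conn (from u) (from v) (from-∈ u∈T) (from-∈ v∈T)))

  bipartite-≅ : Bipartite T → Bipartite S
  bipartite-≅ (colour , proper) = colour ∘ to , λ u v a → proper (to u) (to v) (adj-≅ a)

  allDiffs-≅ : AllDiffs S → AllDiffs T
  allDiffs-≅ all k k≢0 with i , j , i∈S , j∈S , d ← all k k≢0 =
    to i , to j , to-∈ i∈S , to-∈ j∈S , trans (diff-to i j) d

rotate-≅ : (S : Subset (suc n)) → S ≅ rotate S
rotate-≅ S = record
  { to = prev ; from = next ; from-to = next-prev ; to-from = prev-next
  ; to-∈ = prev-∈-rotate
  ; from-∈ = λ {i} i∈ → prev-∈-rotate⁻ (subst (_∈ rotate S) (sym (prev-next i)) i∈)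
  ; diff-to = diff-prev }

CoverClaim : {p : ℕ} → ℕ → Subset p → Set
CoverClaim X S = ∣ S ∣ ≡ X → AllDiffs S → Connected S × ¬ Bipartite S

claim-≅ : ∀ {p X} {S T : Subset p} → S ≅ T → ∣ S ∣ ≡ ∣ T ∣ → CoverClaim X T → CoverClaim X S
claim-≅ S≅T ∣S∣≡∣T∣ claim ∣S∣≡X allDiffs
  with connected , nonBipartite ← claim (trans (sym ∣S∣≡∣T∣) ∣S∣≡X) (allDiffs-≅ S≅T allDiffs) =
  connected-≅ (≅-sym S≅T) connected , nonBipartite ∘ bipartite-≅ (≅-sym S≅T)

claim-anchored⇒claim : ∀ {X} → (∀ S → zero ∈ S → CoverClaim X S) →
                       (S : Subset (suc n)) → Nonempty S → CoverClaim X S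
claim-anchored⇒claim {X = X} claim₀ S (i , i∈S) = <-weakInduction P claim₀ shift i S i∈S
  where
  P : Fin _ → Set
  P i = ∀ S → i ∈ S → CoverClaim X S
  shift : ∀ j → P (inject₁ j) → P (suc j)
  shift j claimⱼ S sj∈S = claim-≅ (rotate-≅ S) (sym (∣rotate∣ S)) (claimⱼ (rotate S) (prev-∈-rotate sj∈S))

-- Uniqueness is tested by a Boolean function: it is the inner loop of the search.
module _ (p : ℕ) where

  uniqueDiffᵇ : List ℕ → ℕ → ℕ → Bool
  uniqueDiffᵇ L a b =
    all (λ a′ → all (λ b′ → ((a′ ≡ᵇ a) ∧ (b′ ≡ᵇ b)) ∨ not (diffℕ p a′ b′ ≡ᵇ diffℕ p a b)) L) L

  AdjIn : List ℕ → ℕ → ℕ → Set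
  AdjIn L a b = T (uniqueDiffᵇ L a b) ⊎ T (uniqueDiffᵇ L b a)

  WithinTwoSteps : List ℕ → ℕ → ℕ → Set
  WithinTwoSteps L a b = a ≡ b ⊎ AdjIn L a b ⊎ Any (λ c → AdjIn L a c × AdjIn L c b) L

  DiameterAtMostTwo : List ℕ → Set
  DiameterAtMostTwo L = All (λ a → All (WithinTwoSteps L a) L) L

  HasTriangle : List ℕ → Set
  HasTriangle L = Any (λ a → Any (λ b → Any (λ c → AdjIn L a b × AdjIn L b c × AdjIn L c a) L) L) L

  Certificate : List ℕ → Set
  Certificate L = DiameterAtMostTwo L × HasTriangle L

  adjIn? : ∀ L a b → Dec (AdjIn L a b)
  adjIn? L a b = T? (uniqueDiffᵇ L a b) ⊎-dec T? (uniqueDiffᵇ L b a)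

  certificate? : ∀ L → Dec (Certificate L)
  certificate? L =
    all? (λ a → all? (λ b → a ℕ.≟ b ⊎-dec adjIn? L a b ⊎-dec
                             any? (λ c → adjIn? L a c ×-dec adjIn? L c b) L) L) L
    ×-dec any? (λ a → any? (λ b → any? (λ c →
                 adjIn? L a b ×-dec adjIn? L b c ×-dec adjIn? L c a) L) L) L

  CoversResidues : List ℕ → Set
  CoversResidues L = (k : Fin p) → toℕ k ≢ 0 → ∃₂ λ a b → a ∈ˡ L × b ∈ˡ L × diffℕ p a b ≡ toℕ k

  uniqueDiffᵇ-sound : ∀ {L a b a′ b′} → T (uniqueDiffᵇ L a b) → a′ ∈ˡ L → b′ ∈ˡ L →
                      a′ ≡ a × b′ ≡ b ⊎ diffℕ p a′ b′ ≢ diffℕ p a b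
  uniqueDiffᵇ-sound {L} {a} {b} {a′} {b′} unique a′∈L b′∈L =
    Sum.map same-pair different-diff (Equivalence.to T-∨ entry)
    where
    entry = All.lookup (all⁺ _ L (All.lookup (all⁺ _ L unique) a′∈L)) b′∈L
    same-pair : T ((a′ ≡ᵇ a) ∧ (b′ ≡ᵇ b)) → a′ ≡ a × b′ ≡ b
    same-pair t with eqᵃ , eqᵇ ← Equivalence.to T-∧ t = ℕ.≡ᵇ⇒≡ a′ a eqᵃ , ℕ.≡ᵇ⇒≡ b′ b eqᵇ
    different-diff : T (not (diffℕ p a′ b′ ≡ᵇ diffℕ p a b)) → diffℕ p a′ b′ ≢ diffℕ p a b
    different-diff t eq = subst (T ∘ not) (Equivalence.to T-≡ (ℕ.≡⇒≡ᵇ _ _ eq)) t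

record Enumerates {p : ℕ} (S : Subset p) (L : List ℕ) : Set where
  field
    ∈⇒∈ˡ : ∀ {i} → i ∈ S → toℕ i ∈ˡ L
    ∈ˡ⇒∈ : ∀ {a} → a ∈ˡ L → ∃ λ i → i ∈ S × toℕ i ≡ a

no-Bool-triangle : {x y z : Bool} → x ≢ y → y ≢ z → z ≢ x → ⊥
no-Bool-triangle x≢y y≢z z≢x =
  z≢x (sym (trans (¬-not x≢y) (trans (cong not (¬-not y≢z)) (not-involutive _))))

module _ {p : ℕ} {S : Subset p} {L : List ℕ} (S≈L : Enumerates S L) where
  open Enumerates S≈L

  uniqueDiffᵇ⇒uniqueDiff : ∀ {i j} → i ∈ S → j ∈ S → T (uniqueDiffᵇ p L (toℕ i) (toℕ j)) → UniqueDiff S i j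
  uniqueDiffᵇ⇒uniqueDiff i∈S j∈S unique = i∈S , j∈S , λ i′ j′ i′∈S j′∈S other →
    [ (λ (eᵢ , eⱼ) → contradiction (toℕ-injective eᵢ , toℕ-injective eⱼ) other) , id ]′
      (uniqueDiffᵇ-sound p unique (∈⇒∈ˡ i′∈S) (∈⇒∈ˡ j′∈S))

  adjIn⇒adj : ∀ {u v} → u ∈ S → v ∈ S → AdjIn p L (toℕ u) (toℕ v) → Adj S u v
  adjIn⇒adj u∈S v∈S = Sum.map (uniqueDiffᵇ⇒uniqueDiff u∈S v∈S) (uniqueDiffᵇ⇒uniqueDiff v∈S u∈S)

  diameterAtMostTwo⇒connected : DiameterAtMostTwo p L → Connected S
  diameterAtMostTwo⇒connected diameter u v u∈S v∈S
    with All.lookup (All.lookup diameter (∈⇒∈ˡ u∈S)) (∈⇒∈ˡ v∈S)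
  ... | inj₁ u≡v = subst (Walk S u) (toℕ-injective u≡v) here
  ... | inj₂ (inj₁ u~v) = step (adjIn⇒adj u∈S v∈S u~v) here
  ... | inj₂ (inj₂ path)
    with c , c∈L , u~c , c~v ← find path
    with w , w∈S , refl ← ∈ˡ⇒∈ c∈L =
    step (adjIn⇒adj u∈S w∈S u~c) (step (adjIn⇒adj w∈S v∈S c~v) here)

  hasTriangle⇒nonBipartite : HasTriangle p L → ¬ Bipartite S
  hasTriangle⇒nonBipartite triangle (colour , proper)
    with a , a∈L , triangleᵃ ← find triangle
    with b , b∈L , triangleᵃᵇ ← find triangleᵃ
    with c , c∈L , a~b , b~c , c~a ← find triangleᵃᵇ
    with i , i∈S , refl ← ∈ˡ⇒∈ a∈L
    with j , j∈S , refl ← ∈ˡ⇒∈ b∈L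
    with k , k∈S , refl ← ∈ˡ⇒∈ c∈L =
    no-Bool-triangle (proper i j (adjIn⇒adj i∈S j∈S a~b))
                     (proper j k (adjIn⇒adj j∈S k∈S b~c))
                     (proper k i (adjIn⇒adj k∈S i∈S c~a))

  allDiffs⇒coversResidues : AllDiffs S → CoversResidues p L
  allDiffs⇒coversResidues allDiffs k k≢0 with i , j , i∈S , j∈S , d ← allDiffs k k≢0 =
    toℕ i , toℕ j , ∈⇒∈ˡ i∈S , ∈⇒∈ˡ j∈S , d

injection⇒≤length : ∀ {m} {A : Set} {xs : List A} (f : Fin m → A) → Injective _≡_ _≡_ f →
                    (∀ k → f k ∈ˡ xs) → m ≤ length xs
injection⇒≤length {m} {xs = xs} f f-injective f∈xs with m ℕ.≤? length xs
... | yes m≤ = m≤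
... | no m≰ with i , j , i<j , same-index ← Fin.pigeonhole (ℕ.≰⇒> m≰) (Any.index ∘ f∈xs) =
  contradiction (f-injective (trans (lookup-index (f∈xs i))
                                    (trans (cong (List.lookup xs) same-index) (sym (lookup-index (f∈xs j))))))
                (Fin.<⇒≢ i<j)

nonzero-residues⇒≤length : ∀ {q} {ds : List ℕ} → (∀ (k : Fin (suc q)) → toℕ k ≢ 0 → toℕ k ∈ˡ ds) →
                           q ≤ length ds
nonzero-residues⇒≤length residue∈ds =
  injection⇒≤length (toℕ ∘ Fin.suc) (toℕ-injective ∘ ℕ.suc-injective) (λ k → residue∈ds (Fin.suc k) λ ())

members : ∀ {r} → Subset r → ℕ → List ℕ → List ℕ
members [] off acc = acc
members (outside ∷ v) off acc = members v (suc off) acc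
members (inside ∷ v) off acc = members v (suc off) (off ∷ acc)

length-members : ∀ {r} (v : Subset r) off acc → length (members v off acc) ≡ ∣ v ∣ + length acc
length-members [] off acc = refl
length-members (outside ∷ v) off acc = length-members v (suc off) acc
length-members (inside ∷ v) off acc = trans (length-members v (suc off) (off ∷ acc)) (+-suc ∣ v ∣ (length acc))

∈-members-acc : ∀ {r} (v : Subset r) off {acc a} → a ∈ˡ acc → a ∈ˡ members v off acc
∈-members-acc [] off a∈acc = a∈acc
∈-members-acc (outside ∷ v) off a∈acc = ∈-members-acc v (suc off) a∈acc
∈-members-acc (inside ∷ v) off a∈acc = ∈-members-acc v (suc off) (there a∈acc)

∈-members : ∀ {r} {v : Subset r} off {acc k} → k ∈ v → off + toℕ k ∈ˡ members v off acc
∈-members {v = _ ∷ v} off here = ∈-members-acc v (suc off) (here (ℕ.+-identityʳ off))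
∈-members {v = outside ∷ v} off {acc} {suc k} (there k∈v) =
  subst (_∈ˡ members v (suc off) acc) (sym (+-suc off (toℕ k))) (∈-members (suc off) k∈v)
∈-members {v = inside ∷ v} off {acc} {suc k} (there k∈v) =
  subst (_∈ˡ members v (suc off) (off ∷ acc)) (sym (+-suc off (toℕ k))) (∈-members (suc off) k∈v)

offset-there : ∀ {r b a} {v : Subset r} off →
               (∃ λ k → k ∈ v × suc off + toℕ k ≡ a) → ∃ λ k → k ∈ b ∷ v × off + toℕ k ≡ a
offset-there off (k , k∈v , eq) = suc k , there k∈v , trans (+-suc off (toℕ k)) eq

∈-members⁻ : ∀ {r} (v : Subset r) off {acc a} → a ∈ˡ members v off acc →
            a ∈ˡ acc ⊎ ∃ λ k → k ∈ v × off + toℕ k ≡ a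
∈-members⁻ [] off a∈ = inj₁ a∈
∈-members⁻ (outside ∷ v) off a∈ = Sum.map₂ (offset-there off) (∈-members⁻ v (suc off) a∈)
∈-members⁻ (inside ∷ v) off a∈ with ∈-members⁻ v (suc off) a∈
... | inj₁ (here refl) = inj₂ (zero , here , ℕ.+-identityʳ off)
... | inj₁ (there a∈acc) = inj₁ a∈acc
... | inj₂ k∈v = inj₂ (offset-there off k∈v)

enumerates-members : ∀ {q} (v : Subset q) → Enumerates (inside ∷ v) (members v 1 (0 ∷ []))
enumerates-members v = record { ∈⇒∈ˡ = ∈⇒∈ˡ ; ∈ˡ⇒∈ = ∈ˡ⇒∈ }
  where
  ∈⇒∈ˡ : ∀ {i} → i ∈ inside ∷ v → toℕ i ∈ˡ members v 1 (0 ∷ [])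
  ∈⇒∈ˡ here = ∈-members-acc v 1 (here refl)
  ∈⇒∈ˡ (there i∈v) = ∈-members 1 i∈v
  ∈ˡ⇒∈ : ∀ {a} → a ∈ˡ members v 1 (0 ∷ []) → ∃ λ i → i ∈ inside ∷ v × toℕ i ≡ a
  ∈ˡ⇒∈ a∈L with ∈-members⁻ v 1 a∈L
  ... | inj₁ (here refl) = zero , here , refl
  ... | inj₂ (k , k∈v , refl) = suc k , there k∈v , refl

insert : ℕ → List ℕ → List ℕ
insert d ds = if any (d ≡ᵇ_) ds then ds else d ∷ ds

length-insert : ∀ d ds → length (insert d ds) ≤ suc (length ds)
length-insert d ds with any (d ≡ᵇ_) ds
... | true = ℕ.n≤1+n (length ds)
... | false = ≤-refl

∈-insert : ∀ d ds → d ∈ˡ insert d ds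
∈-insert d ds with any (d ≡ᵇ_) ds in found
... | true = Any.map (λ {e} → ℕ.≡ᵇ⇒≡ d e) (any⁻ (d ≡ᵇ_) ds (Equivalence.from T-≡ found))
... | false = here refl

∈-insert-keep : ∀ {e} d ds → e ∈ˡ ds → e ∈ˡ insert d ds
∈-insert-keep d ds e∈ds with any (d ≡ᵇ_) ds
... | true = e∈ds
... | false = there e∈ds

module _ (p : ℕ) where

  extend : ℕ → List ℕ → List ℕ → List ℕ
  extend x [] ds = ds
  extend x (y ∷ ys) ds = extend x ys (insert (diffℕ p x y) (insert (diffℕ p y x) ds))

  length-extend : ∀ x ys ds → length (extend x ys ds) ≤ length ds + 2 * length ys
  length-extend x [] ds = ℕ.m≤m+n (length ds) 0
  length-extend x (y ∷ ys) ds = begin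
    length (extend x ys ds′)         ≤⟨ length-extend x ys ds′ ⟩
    length ds′ + 2 * length ys       ≤⟨ ℕ.+-monoˡ-≤ (2 * length ys) length-ds′ ⟩
    length ds + 2 + 2 * length ys    ≡⟨ ℕ.+-assoc (length ds) 2 (2 * length ys) ⟩
    length ds + (2 + 2 * length ys)  ≡⟨ cong (length ds +_) (ℕ.*-suc 2 (length ys)) ⟨
    length ds + 2 * suc (length ys)  ∎
    where
    open ℕ.≤-Reasoning
    ds′ = insert (diffℕ p x y) (insert (diffℕ p y x) ds)
    length-ds′ : length ds′ ≤ length ds + 2
    length-ds′ = ℕ.≤-trans (length-insert (diffℕ p x y) (insert (diffℕ p y x) ds))
                   (ℕ.≤-trans (ℕ.s≤s (length-insert (diffℕ p y x) ds))
                              (ℕ.≤-reflexive (ℕ.+-comm 2 (length ds))))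

  ∈-extend-keep : ∀ {e} x ys {ds} → e ∈ˡ ds → e ∈ˡ extend x ys ds
  ∈-extend-keep x [] e∈ds = e∈ds
  ∈-extend-keep x (y ∷ ys) {ds} e∈ds =
    ∈-extend-keep x ys (∈-insert-keep (diffℕ p x y) _ (∈-insert-keep (diffℕ p y x) ds e∈ds))

  ∈-extend : ∀ x {ys y} ds → y ∈ˡ ys → diffℕ p x y ∈ˡ extend x ys ds × diffℕ p y x ∈ˡ extend x ys ds
  ∈-extend x {y ∷ ys} ds (here refl) =
    ∈-extend-keep x ys (∈-insert (diffℕ p x y) ds′) ,
    ∈-extend-keep x ys (∈-insert-keep (diffℕ p x y) ds′ (∈-insert (diffℕ p y x) ds))
    where ds′ = insert (diffℕ p y x) ds
  ∈-extend x {z ∷ ys} ds (there y∈ys) = ∈-extend x (insert (diffℕ p x z) (insert (diffℕ p z x) ds)) y∈ys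

  DifferencesIn : List ℕ → List ℕ → Set
  DifferencesIn acc ds = ∀ {a b} → a ∈ˡ acc → b ∈ˡ acc → diffℕ p a b ≡ 0 ⊎ diffℕ p a b ∈ˡ ds

  differencesIn-extend : ∀ {x acc ds} → DifferencesIn acc ds → DifferencesIn (x ∷ acc) (extend x acc ds)
  differencesIn-extend {x} _ (here refl) (here refl) = inj₁ (diffℕ-self p x)
  differencesIn-extend {x} {ds = ds} _ (here refl) (there b∈acc) = inj₂ (proj₁ (∈-extend x ds b∈acc))
  differencesIn-extend {x} {ds = ds} _ (there a∈acc) (here refl) = inj₂ (proj₂ (∈-extend x ds a∈acc))
  differencesIn-extend {x} {acc} inv (there a∈acc) (there b∈acc) =
    Sum.map₂ (∈-extend-keep x acc) (inv a∈acc b∈acc)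

T-if-yes : ∀ {A : Set} (a? : Dec A) {b} → T (if ⌊ a? ⌋ then b else true) → A → T b
T-if-yes (yes _) found _ = found
T-if-yes (no ¬a) _ a = contradiction a ¬a

module Search (q X : ℕ) where

  -- Adding an element x to a set of a elements creates at most the 2a new differences x - y, y - x.
  differenceBudget : ℕ → ℕ → ℕ
  differenceBudget a zero = 0
  differenceBudget a (suc t) = 2 * a + differenceBudget (suc a) t

  Viable : ℕ → ℕ → ℕ → Set
  Viable a c r = a ≤ X × X ≤ a + r × q ≤ c + differenceBudget a (X ∸ a)

  viable? : ∀ a c r → Dec (Viable a c r)
  viable? a c r = a ℕ.≤? X ×-dec X ℕ.≤? a + r ×-dec q ℕ.≤? c + differenceBudget a (X ∸ a)

  -- search r off acc ds decides which of off, …, off + r - 1 to add to acc; ds collects the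
  -- nonzero differences of acc.
  search : ℕ → ℕ → List ℕ → List ℕ → Bool
  search zero off acc ds =
    if ⌊ viable? (length acc) (length ds) zero ⌋ then ⌊ certificate? (suc q) acc ⌋ else true
  search (suc r) off acc ds =
    if ⌊ viable? (length acc) (length ds) (suc r) ⌋
    then search r (suc off) (off ∷ acc) (extend (suc q) off acc ds) ∧ search r (suc off) acc ds
    else true

  IsCover : List ℕ → Set
  IsCover L = length L ≡ X × CoversResidues (suc q) L

  nonzero-residues≤budget : ∀ {r} (v : Subset r) off acc ds → DifferencesIn (suc q) acc ds →
                            IsCover (members v off acc) →
                            q ≤ length ds + differenceBudget (length acc) (X ∸ length acc)
  nonzero-residues≤budget [] off acc ds inv (_ , covers) =
    ℕ.≤-trans (nonzero-residues⇒≤length residue∈ds) (ℕ.m≤m+n (length ds) _)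
    where
    residue∈ds : ∀ k → toℕ k ≢ 0 → toℕ k ∈ˡ ds
    residue∈ds k k≢0 with a , b , a∈acc , b∈acc , d ← covers k k≢0 with inv a∈acc b∈acc
    ... | inj₁ d≡0 = contradiction (trans (sym d) d≡0) k≢0
    ... | inj₂ d∈ds = subst (_∈ˡ ds) d d∈ds
  nonzero-residues≤budget (outside ∷ v) off acc ds inv = nonzero-residues≤budget v (suc off) acc ds inv
  nonzero-residues≤budget (inside ∷ v) off acc ds inv cover@(size , _) = begin
    q                                      ≤⟨ nonzero-residues≤budget v (suc off) (off ∷ acc) ds′ inv′ cover ⟩
    length ds′ + budget′                   ≤⟨ ℕ.+-monoˡ-≤ budget′ (length-extend (suc q) off acc ds) ⟩
    length ds + 2 * a + budget′            ≡⟨ ℕ.+-assoc (length ds) (2 * a) budget′ ⟩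
    length ds + (2 * a + budget′)          ≡⟨ cong (λ t → length ds + differenceBudget a t) (ℕ.+-∸-assoc 1 a<X) ⟨
    length ds + differenceBudget a (X ∸ a) ∎
    where
    open ℕ.≤-Reasoning
    a = length acc
    ds′ = extend (suc q) off acc ds
    inv′ = differencesIn-extend (suc q) inv
    budget′ = differenceBudget (suc a) (X ∸ suc a)
    a<X : a < X
    a<X = subst (suc a ≤_) (trans (sym (length-members v (suc off) (off ∷ acc))) size) (ℕ.m≤n+m (suc a) ∣ v ∣)

  viable-on-path : ∀ {r} (v : Subset r) off acc ds → DifferencesIn (suc q) acc ds →
                   IsCover (members v off acc) → Viable (length acc) (length ds) r
  viable-on-path {r} v off acc ds inv cover@(size , _) =
    subst (length acc ≤_) ∣v∣+a≡X (ℕ.m≤n+m (length acc) ∣ v ∣) ,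
    subst (_≤ length acc + r) ∣v∣+a≡X
      (ℕ.≤-trans (ℕ.+-monoˡ-≤ (length acc) (∣p∣≤n v)) (ℕ.≤-reflexive (ℕ.+-comm r (length acc)))) ,
    nonzero-residues≤budget v off acc ds inv cover
    where
    ∣v∣+a≡X : ∣ v ∣ + length acc ≡ X
    ∣v∣+a≡X = trans (sym (length-members v off acc)) size

  search-children : ∀ {r} (v : Subset (suc r)) off acc ds → DifferencesIn (suc q) acc ds →
                    T (search (suc r) off acc ds) → IsCover (members v off acc) →
                    T (search r (suc off) (off ∷ acc) (extend (suc q) off acc ds)) × T (search r (suc off) acc ds)
  search-children {r} v off acc ds inv found cover =
    Equivalence.to T-∧ (T-if-yes (viable? (length acc) (length ds) (suc r)) found (viable-on-path v off acc ds inv cover))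

  search-sound : ∀ {r} (v : Subset r) off acc ds → DifferencesIn (suc q) acc ds →
                 T (search r off acc ds) → IsCover (members v off acc) → Certificate (suc q) (members v off acc)
  search-sound [] off acc ds inv found cover =
    toWitness {a? = certificate? (suc q) acc}
      (T-if-yes (viable? (length acc) (length ds) 0) found (viable-on-path [] off acc ds inv cover))
  search-sound (inside ∷ v) off acc ds inv found cover =
    search-sound v (suc off) (off ∷ acc) _ (differencesIn-extend (suc q) inv)
                 (proj₁ (search-children (inside ∷ v) off acc ds inv found cover)) cover
  search-sound (outside ∷ v) off acc ds inv found cover =
    search-sound v (suc off) acc ds inv (proj₂ (search-children (outside ∷ v) off acc ds inv found cover)) cover

  claim-from-search : search q 1 (0 ∷ []) [] ≡ true → (S : Subset (suc q)) → zero ∈ S → CoverClaim X S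
  claim-from-search found (inside ∷ v) here ∣S∣≡X allDiffs =
    diameterAtMostTwo⇒connected S≈L (proj₁ certificate) , hasTriangle⇒nonBipartite S≈L (proj₂ certificate)
    where
    S≈L = enumerates-members v
    size : length (members v 1 (0 ∷ [])) ≡ X
    size = trans (length-members v 1 (0 ∷ [])) (trans (ℕ.+-comm ∣ v ∣ 1) ∣S∣≡X)
    differencesIn-0 : DifferencesIn (suc q) (0 ∷ []) []
    differencesIn-0 (here refl) (here refl) = inj₁ refl
    certificate : Certificate (suc q) (members v 1 (0 ∷ []))
    certificate = search-sound v 1 (0 ∷ []) [] differencesIn-0 (Equivalence.from T-≡ found)
                               (size , allDiffs⇒coversResidues S≈L allDiffs)

nonempty : ∀ {n k} (S : Subset n) → ∣ S ∣ ≡ suc k → Nonempty S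
nonempty {n} S ∣S∣≡1+k with nonempty? S
... | yes S≢∅ = S≢∅
... | no S≡∅ = contradiction (trans (sym ∣S∣≡1+k) (trans (cong ∣_∣ (Empty-unique S≡∅)) (∣⊥∣≡0 n))) λ ()

cover⇒connected-nonBipartite : ∀ q X → Search.search q (suc X) q 1 (0 ∷ []) [] ≡ true →
                               (S : Subset (suc q)) → ∣ S ∣ ≡ suc X → AllDiffs S → Connected S × ¬ Bipartite S
cover⇒connected-nonBipartite q X found S ∣S∣≡1+X =
  claim-anchored⇒claim (Search.claim-from-search q (suc X) found) S (nonempty S ∣S∣≡1+X) ∣S∣≡1+X

lemma5p3 : (p X : ℕ) → Params p X → (S : Subset p) → ∣ S ∣ ≡ X → AllDiffs S →
    Connected S × ¬ Bipartite S
lemma5p3 .7 .3 p7 = cover⇒connected-nonBipartite 6 2 refl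
lemma5p3 .11 .4 p11 = cover⇒connected-nonBipartite 10 3 refl
lemma5p3 .13 .4 p13 = cover⇒connected-nonBipartite 12 3 refl
lemma5p3 .17 .5 p17 = cover⇒connected-nonBipartite 16 4 refl
lemma5p3 .19 .5 p19 = cover⇒connected-nonBipartite 18 4 refl
lemma5p3 .29 .6 p29 = cover⇒connected-nonBipartite 28 5 refl
lemma5p3 .31 .6 p31 = cover⇒connected-nonBipartite 30 5 refl
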